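{- The algorithm SQEMA succeeds on every conjunction of monadic inductive formulae.
   Context: Basic modal language $\mathrm{ML}$: $\top,\bot$, propositional variables, $\neg,\wedge,\vee,\rightarrow,\Diamond,\Box$. A formula is positive if every occurrence of a propositional variable is in the scope of an even number of negations. Box-forms of a symbol $\sharp$: $\sharp$ is one; if $\mathbf{B}(\sharp)$ is one then so are $\Box\mathbf{B}(\sharp)$ and $A\rightarrow\mathbf{B}(\sharp)$ for any positive formula $A$. Substituting a propositional variable $p$ for $\sharp$ gives a box-formula $\mathbf{B}(p)$ of $p$; that (last) occurrence of $p$ is its head, all other variable occurrences in it are inessential. A monadic regular formula is built from $\top$, $\bot$, positive formulae and negated box-formulae using $\wedge$, $\vee$, $\Box$. The dependency digraph of a set of box-formulae has as vertices their heads, with an edge $p_i\to p_j$ iff $p_i$ occurs as an inessential variable in a box-formula of the set with head $p_j$; the dependency digraph of a formula is that of the set of box-formulae occurring as its subformulae. A monadic inductive formula is a monadic regular formula whose dependency digraph is acyclic (no oriented cycles, including loops). $\mathrm{ML}^+$ adds nominals (denoting singletons; disregarded for polarity) and $\Diamond^{ -1},\Box^{ -1}$. SQEMA rewriting rules on systems (finite sets) of equations $\alpha\rightarrow\beta$ in $\mathrm{ML}^+$: $\wedge$-rule ($\beta\rightarrow\gamma\wedge\delta$ becomes $\beta\rightarrow\gamma$, $\beta\rightarrow\delta$); left-shift $\vee$-rule ($\beta\rightarrow\gamma\vee\delta$ becomes $(\beta\wedge\neg\gamma)\rightarrow\delta$) and its converse; left-shift $\Box$-rule ($\gamma\rightarrow\Box\delta$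 becomes $\Diamond^{ -1}\gamma\rightarrow\delta$) and its converse; $\Diamond$-rule ($\mathbf{j}\rightarrow\Diamond\gamma$, $\mathbf{j}$ a nominal, becomes $\mathbf{j}\rightarrow\Diamond\mathbf{k}$, $\mathbf{k}\rightarrow\gamma$, $\mathbf{k}$ a new nominal); Ackermann-rule (if the equations containing $p$ are exactly $\alpha_1\rightarrow p,\ldots,\alpha_n\rightarrow p$ with $p$ not in the $\alpha$'s, and $\beta_1,\ldots,\beta_m$ each negative in $p$, replace them by $\beta_j[(\alpha_1\vee\cdots\vee\alpha_n)/p]$); polarity switching (replace $p$ by $\neg p$ and $\neg p$ by $p$ throughout); auxiliary propositional simplification rules ($\gamma\vee\neg\gamma\mapsto\top$, $\gamma\wedge\bot\mapsto\bot$, etc., and $\neg\Diamond\neg\mapsto\Box$, $\neg\Box\neg\mapsto\Diamond$). On input $\phi\in\mathrm{ML}$: (1) put $\neg\phi$ in negation normal form and distribute $\Diamond$ and $\wedge$ over $\vee$ as much as possible, giving $\bigvee_k\alpha_k$; (2) for each $k$ start from the system $\{\mathbf{i}\rightarrow\alpha_k\}$, $\mathbf{i}$ a reserved nominal; (3) replace every variable in which the system is positive (negative) by $\top$ ($\bot$); (4–5) repeatedly choose a remaining variable and apply the rules (possibly polarity switching) so as to enable and apply the Ackermann-rule to eliminate it, backtracking over choices. SQEMA succeeds on $\phi$ if for every disjunct $\alpha_k$ some sequence of such steps yields a system containing no propositional variables. -}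

module Defs where

open import Data.Nat using (ℕ; zero; suc; _≡ᵇ_)
open import Data.Bool using (Bool; true; false; not; _∨_; _∧_; if_then_else_)
open import Data.List using (List; []; _∷_; map; _++_; concatMap)
open import Data.List.Relation.Unary.All using (All)
open import Data.List.Membership.Propositional using (_∈_)
open import Data.List.Relation.Binary.Subset.Propositional using (_⊆_)
open import Data.Product using (Σ; _×_; ∃)
open import Relation.Binary.PropositionalEquality using (_≡_; _≢_)
open import Relation.Binary.Construct.Closure.Transitive using (TransClosure)
open import Relation.Binary.Construct.Closure.ReflexiveTransitive using (Star)
open import Relation.Nullary using (¬_)

infixr 36 _∧ₘ_
infixr 35 _∨ₘ_
infixr 34 _⇒ₘ_
infix 40 ¬ₘ_ ◇ₘ_ □ₘ_

data Fm : Set where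
  ⊤ₘ ⊥ₘ : Fm
  var   : ℕ → Fm
  ¬ₘ_   : Fm → Fm
  _∧ₘ_ _∨ₘ_ _⇒ₘ_ : Fm → Fm → Fm
  ◇ₘ_ □ₘ_ : Fm → Fm

infixr 36 _∧⁺_
infixr 35 _∨⁺_
infixr 34 _⇒⁺_
infix 40 ¬⁺_ ◇⁺_ □⁺_ ◇⁻_ □⁻_
infix 4 _⊑_ _↦_ _↝_

data Fm⁺ : Set where
  ⊤⁺ ⊥⁺ : Fm⁺
  var⁺  : ℕ → Fm⁺
  nom   : ℕ → Fm⁺
  ¬⁺_   : Fm⁺ → Fm⁺
  _∧⁺_ _∨⁺_ _⇒⁺_ : Fm⁺ → Fm⁺ → Fm⁺
  ◇⁺_ □⁺_ ◇⁻_ □⁻_ : Fm⁺ → Fm⁺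

⌜_⌝ : Fm → Fm⁺
⌜ ⊤ₘ ⌝ = ⊤⁺
⌜ ⊥ₘ ⌝ = ⊥⁺
⌜ var p ⌝ = var⁺ p
⌜ ¬ₘ a ⌝ = ¬⁺ ⌜ a ⌝
⌜ a ∧ₘ b ⌝ = ⌜ a ⌝ ∧⁺ ⌜ b ⌝
⌜ a ∨ₘ b ⌝ = ⌜ a ⌝ ∨⁺ ⌜ b ⌝
⌜ a ⇒ₘ b ⌝ = ⌜ a ⌝ ⇒⁺ ⌜ b ⌝
⌜ ◇ₘ a ⌝ = ◇⁺ ⌜ a ⌝
⌜ □ₘ a ⌝ = □⁺ ⌜ a ⌝

-- Polarity.  occ b p φ = true iff p has an occurrence in φ of polarity b
-- (true = positive, i.e. under an even number of negations).  Following
-- the usual convention, the antecedent of → counts as a negation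
-- (α → β abbreviates ¬α ∨ β).

occ : Bool → ℕ → Fm⁺ → Bool
occ b p ⊤⁺ = false
occ b p ⊥⁺ = false
occ b p (var⁺ q) = b ∧ (q ≡ᵇ p)
occ b p (nom _) = false
occ b p (¬⁺ a) = occ (not b) p a
occ b p (a ∧⁺ c) = occ b p a ∨ occ b p c
occ b p (a ∨⁺ c) = occ b p a ∨ occ b p c
occ b p (a ⇒⁺ c) = occ (not b) p a ∨ occ b p c
occ b p (◇⁺ a) = occ b p a
occ b p (□⁺ a) = occ b p a
occ b p (◇⁻ a) = occ b p a
occ b p (□⁻ a) = occ b p a

occurs⁺ : ℕ → Fm⁺ → Bool
occurs⁺ p φ = occ true p φ ∨ occ false p φ

occurs : ℕ → Fm → Bool
occurs p φ = occurs⁺ p ⌜ φ ⌝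

hasVar : Fm⁺ → Bool
hasVar ⊤⁺ = false
hasVar ⊥⁺ = false
hasVar (var⁺ _) = true
hasVar (nom _) = false
hasVar (¬⁺ a) = hasVar a
hasVar (a ∧⁺ c) = hasVar a ∨ hasVar c
hasVar (a ∨⁺ c) = hasVar a ∨ hasVar c
hasVar (a ⇒⁺ c) = hasVar a ∨ hasVar c
hasVar (◇⁺ a) = hasVar a
hasVar (□⁺ a) = hasVar a
hasVar (◇⁻ a) = hasVar a
hasVar (□⁻ a) = hasVar a

hasNom : ℕ → Fm⁺ → Bool
hasNom j ⊤⁺ = false
hasNom j ⊥⁺ = false
hasNom j (var⁺ _) = false
hasNom j (nom k) = k ≡ᵇ j
hasNom j (¬⁺ a) = hasNom j a
hasNom j (a ∧⁺ c) = hasNom j a ∨ hasNom j c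
hasNom j (a ∨⁺ c) = hasNom j a ∨ hasNom j c
hasNom j (a ⇒⁺ c) = hasNom j a ∨ hasNom j c
hasNom j (◇⁺ a) = hasNom j a
hasNom j (□⁺ a) = hasNom j a
hasNom j (◇⁻ a) = hasNom j a
hasNom j (□⁻ a) = hasNom j a

record Positive (A : Fm) : Set where
  constructor positive
  field
    noNegOcc : ∀ p → occ false p ⌜ A ⌝ ≡ false

data IsBox (p : ℕ) : Fm → Set where
  bvar : IsBox p (var p)
  bbox : ∀ {B} → IsBox p B → IsBox p (□ₘ B)
  bimp : ∀ {A B} → Positive A → IsBox p B → IsBox p (A ⇒ₘ B)

data Inessential (q : ℕ) {p : ℕ} : {B : Fm} → IsBox p B → Set where
  ibox  : ∀ {B} {b : IsBox p B} → Inessential q b → Inessential q (bbox b)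
  ihere : ∀ {A B} {a : Positive A} {b : IsBox p B} →
          occurs q A ≡ true → Inessential q (bimp a b)
  ithere : ∀ {A B} {a : Positive A} {b : IsBox p B} →
           Inessential q b → Inessential q (bimp a b)

data _⊑_ : Fm → Fm → Set where
  ⊑refl : ∀ {a} → a ⊑ a
  ⊑¬  : ∀ {a b} → a ⊑ b → a ⊑ ¬ₘ b
  ⊑∧ˡ : ∀ {a b c} → a ⊑ b → a ⊑ (b ∧ₘ c)
  ⊑∧ʳ : ∀ {a b c} → a ⊑ c → a ⊑ (b ∧ₘ c)
  ⊑∨ˡ : ∀ {a b c} → a ⊑ b → a ⊑ (b ∨ₘ c)
  ⊑∨ʳ : ∀ {a b c} → a ⊑ c → a ⊑ (b ∨ₘ c)
  ⊑⇒ˡ : ∀ {a b c} → a ⊑ b → a ⊑ (b ⇒ₘ c)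
  ⊑⇒ʳ : ∀ {a b c} → a ⊑ c → a ⊑ (b ⇒ₘ c)
  ⊑◇  : ∀ {a b} → a ⊑ b → a ⊑ ◇ₘ b
  ⊑□  : ∀ {a b} → a ⊑ b → a ⊑ □ₘ b

data Regular : Fm → Set where
  r⊤   : Regular ⊤ₘ
  r⊥   : Regular ⊥ₘ
  rpos : ∀ {A} → Positive A → Regular A
  rneg : ∀ {p B} → IsBox p B → Regular (¬ₘ B)
  r∧   : ∀ {a b} → Regular a → Regular b → Regular (a ∧ₘ b)
  r∨   : ∀ {a b} → Regular a → Regular b → Regular (a ∨ₘ b)
  r□   : ∀ {a} → Regular a → Regular (□ₘ a)

Edge : Fm → ℕ → ℕ → Set
Edge φ q p = Σ Fm λ B → B ⊑ φ × Σ (IsBox p B) λ b → Inessential q b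

Acyclic : Fm → Set
Acyclic φ = ∀ p → ¬ TransClosure (Edge φ) p p

MonadicInductive : Fm → Set
MonadicInductive φ = Regular φ × Acyclic φ

data ConjOfInductive : Fm → Set where
  single : ∀ {φ} → MonadicInductive φ → ConjOfInductive φ
  conj   : ∀ {φ ψ} → ConjOfInductive φ → ConjOfInductive ψ →
           ConjOfInductive (φ ∧ₘ ψ)

-- nnf true φ = NNF of φ;  nnf false φ = NNF of ¬φ
nnf : Bool → Fm → Fm
nnf true ⊤ₘ = ⊤ₘ
nnf false ⊤ₘ = ⊥ₘ
nnf true ⊥ₘ = ⊥ₘ
nnf false ⊥ₘ = ⊤ₘ
nnf true (var p) = var p
nnf false (var p) = ¬ₘ var p
nnf s (¬ₘ a) = nnf (not s) a
nnf true (a ∧ₘ b) = nnf true a ∧ₘ nnf true b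
nnf false (a ∧ₘ b) = nnf false a ∨ₘ nnf false b
nnf true (a ∨ₘ b) = nnf true a ∨ₘ nnf true b
nnf false (a ∨ₘ b) = nnf false a ∧ₘ nnf false b
nnf true (a ⇒ₘ b) = nnf false a ∨ₘ nnf true b
nnf false (a ⇒ₘ b) = nnf true a ∧ₘ nnf false b
nnf true (◇ₘ a) = ◇ₘ nnf true a
nnf false (◇ₘ a) = □ₘ nnf false a
nnf true (□ₘ a) = □ₘ nnf true a
nnf false (□ₘ a) = ◇ₘ nnf false a

⋁ₘ : List Fm → Fm
⋁ₘ [] = ⊥ₘ
⋁ₘ (a ∷ []) = a
⋁ₘ (a ∷ as) = a ∨ₘ ⋁ₘ as

dist : Fm → List Fm
dist (a ∨ₘ b) = dist a ++ dist b
dist (a ∧ₘ b) = concatMap (λ x → map (λ y → x ∧ₘ y) (dist b)) (dist a)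
dist (◇ₘ a) = map ◇ₘ_ (dist a)
dist (□ₘ a) = □ₘ (⋁ₘ (dist a)) ∷ []
dist φ = φ ∷ []

disjuncts : Fm → List Fm
disjuncts φ = dist (nnf false φ)

infix 3 _⟹_
record Eqn : Set where
  constructor _⟹_
  field
    lhs rhs : Fm⁺
open Eqn public

System : Set
System = List Eqn

-- an equation α → β read as the formula α → β (for polarity purposes)
eqFm : Eqn → Fm⁺
eqFm (a ⟹ b) = a ⇒⁺ b

-- the reserved nominal i
𝐢 : Fm⁺
𝐢 = nom 0

sub : (ℕ → Fm⁺) → Fm⁺ → Fm⁺
sub σ ⊤⁺ = ⊤⁺
sub σ ⊥⁺ = ⊥⁺
sub σ (var⁺ q) = σ q
sub σ (nom j) = nom j
sub σ (¬⁺ a) = ¬⁺ sub σ a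
sub σ (a ∧⁺ c) = sub σ a ∧⁺ sub σ c
sub σ (a ∨⁺ c) = sub σ a ∨⁺ sub σ c
sub σ (a ⇒⁺ c) = sub σ a ⇒⁺ sub σ c
sub σ (◇⁺ a) = ◇⁺ sub σ a
sub σ (□⁺ a) = □⁺ sub σ a
sub σ (◇⁻ a) = ◇⁻ sub σ a
sub σ (□⁻ a) = □⁻ sub σ a

_[_/_] : Fm⁺ → Fm⁺ → ℕ → Fm⁺
φ [ γ / p ] = sub (λ q → if q ≡ᵇ p then γ else var⁺ q) φ

substEq : Fm⁺ → ℕ → Eqn → Eqn
substEq γ p (a ⟹ b) = (a [ γ / p ]) ⟹ (b [ γ / p ])

⋁⁺ : List Fm⁺ → Fm⁺
⋁⁺ [] = ⊥⁺
⋁⁺ (a ∷ []) = a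
⋁⁺ (a ∷ as) = a ∨⁺ ⋁⁺ as

switch : ℕ → Fm⁺ → Fm⁺
switch p ⊤⁺ = ⊤⁺
switch p ⊥⁺ = ⊥⁺
switch p (var⁺ q) = if q ≡ᵇ p then ¬⁺ var⁺ q else var⁺ q
switch p (nom j) = nom j
switch p (¬⁺ var⁺ q) = if q ≡ᵇ p then var⁺ q else ¬⁺ var⁺ q
switch p (¬⁺ a) = ¬⁺ switch p a
switch p (a ∧⁺ c) = switch p a ∧⁺ switch p c
switch p (a ∨⁺ c) = switch p a ∨⁺ switch p c
switch p (a ⇒⁺ c) = switch p a ⇒⁺ switch p c
switch p (◇⁺ a) = ◇⁺ switch p a
switch p (□⁺ a) = □⁺ switch p a
switch p (◇⁻ a) = ◇⁻ switch p a
switch p (□⁻ a) = □⁻ switch p a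

switchEq : ℕ → Eqn → Eqn
switchEq p (a ⟹ b) = switch p a ⟹ switch p b

data _↦_ : Fm⁺ → Fm⁺ → Set where
  em₁  : ∀ {a} → (a ∨⁺ ¬⁺ a) ↦ ⊤⁺
  em₂  : ∀ {a} → (¬⁺ a ∨⁺ a) ↦ ⊤⁺
  nc₁  : ∀ {a} → (a ∧⁺ ¬⁺ a) ↦ ⊥⁺
  nc₂  : ∀ {a} → (¬⁺ a ∧⁺ a) ↦ ⊥⁺
  ∧⊥₁  : ∀ {a} → (a ∧⁺ ⊥⁺) ↦ ⊥⁺
  ∧⊥₂  : ∀ {a} → (⊥⁺ ∧⁺ a) ↦ ⊥⁺
  ∧⊤₁  : ∀ {a} → (a ∧⁺ ⊤⁺) ↦ a
  ∧⊤₂  : ∀ {a} → (⊤⁺ ∧⁺ a) ↦ a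
  ∨⊤₁  : ∀ {a} → (a ∨⁺ ⊤⁺) ↦ ⊤⁺
  ∨⊤₂  : ∀ {a} → (⊤⁺ ∨⁺ a) ↦ ⊤⁺
  ∨⊥₁  : ∀ {a} → (a ∨⁺ ⊥⁺) ↦ a
  ∨⊥₂  : ∀ {a} → (⊥⁺ ∨⁺ a) ↦ a
  ¬⊤   : (¬⁺ ⊤⁺) ↦ ⊥⁺
  ¬⊥   : (¬⁺ ⊥⁺) ↦ ⊤⁺
  ¬¬   : ∀ {a} → (¬⁺ ¬⁺ a) ↦ a
  ⊥⇒   : ∀ {a} → (⊥⁺ ⇒⁺ a) ↦ ⊤⁺
  ⇒⊤   : ∀ {a} → (a ⇒⁺ ⊤⁺) ↦ ⊤⁺
  ⊤⇒   : ∀ {a} → (⊤⁺ ⇒⁺ a) ↦ a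
  ⇒⊥   : ∀ {a} → (a ⇒⁺ ⊥⁺) ↦ ¬⁺ a
  ◇⊥   : (◇⁺ ⊥⁺) ↦ ⊥⁺
  □⊤   : (□⁺ ⊤⁺) ↦ ⊤⁺
  ◇⁻⊥  : (◇⁻ ⊥⁺) ↦ ⊥⁺
  □⁻⊤  : (□⁻ ⊤⁺) ↦ ⊤⁺
  ¬◇¬  : ∀ {a} → (¬⁺ ◇⁺ ¬⁺ a) ↦ □⁺ a
  ¬□¬  : ∀ {a} → (¬⁺ □⁺ ¬⁺ a) ↦ ◇⁺ a
  ¬◇⁻¬ : ∀ {a} → (¬⁺ ◇⁻ ¬⁺ a) ↦ □⁻ a
  ¬□⁻¬ : ∀ {a} → (¬⁺ □⁻ ¬⁺ a) ↦ ◇⁻ a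
  ∧comm : ∀ {a b} → (a ∧⁺ b) ↦ (b ∧⁺ a)
  ∨comm : ∀ {a b} → (a ∨⁺ b) ↦ (b ∨⁺ a)
  ∧assoc₁ : ∀ {a b c} → ((a ∧⁺ b) ∧⁺ c) ↦ (a ∧⁺ (b ∧⁺ c))
  ∧assoc₂ : ∀ {a b c} → (a ∧⁺ (b ∧⁺ c)) ↦ ((a ∧⁺ b) ∧⁺ c)
  ∨assoc₁ : ∀ {a b c} → ((a ∨⁺ b) ∨⁺ c) ↦ (a ∨⁺ (b ∨⁺ c))
  ∨assoc₂ : ∀ {a b c} → (a ∨⁺ (b ∨⁺ c)) ↦ ((a ∨⁺ b) ∨⁺ c)

data _↝_ : Fm⁺ → Fm⁺ → Set where
  root : ∀ {a b} → a ↦ b → a ↝ b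
  c¬   : ∀ {a a'} → a ↝ a' → (¬⁺ a) ↝ (¬⁺ a')
  c∧ˡ  : ∀ {a a' b} → a ↝ a' → (a ∧⁺ b) ↝ (a' ∧⁺ b)
  c∧ʳ  : ∀ {a b b'} → b ↝ b' → (a ∧⁺ b) ↝ (a ∧⁺ b')
  c∨ˡ  : ∀ {a a' b} → a ↝ a' → (a ∨⁺ b) ↝ (a' ∨⁺ b)
  c∨ʳ  : ∀ {a b b'} → b ↝ b' → (a ∨⁺ b) ↝ (a ∨⁺ b')
  c⇒ˡ  : ∀ {a a' b} → a ↝ a' → (a ⇒⁺ b) ↝ (a' ⇒⁺ b)
  c⇒ʳ  : ∀ {a b b'} → b ↝ b' → (a ⇒⁺ b) ↝ (a ⇒⁺ b')
  c◇   : ∀ {a a'} → a ↝ a' → (◇⁺ a) ↝ (◇⁺ a')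
  c□   : ∀ {a a'} → a ↝ a' → (□⁺ a) ↝ (□⁺ a')
  c◇⁻  : ∀ {a a'} → a ↝ a' → (◇⁻ a) ↝ (◇⁻ a')
  c□⁻  : ∀ {a a'} → a ↝ a' → (□⁻ a) ↝ (□⁻ a')

-- one SQEMA rewriting step on systems.  Systems are finite sets,
-- represented by lists up to equality of their element sets (rule `set`).
infix 2 _⇛_
data _⇛_ : System → System → Set where
  set   : ∀ {S S'} → S ⊆ S' → S' ⊆ S → S ⇛ S'
  ∧-rule : ∀ {β γ δ S} → ((β ⟹ γ ∧⁺ δ) ∷ S) ⇛ ((β ⟹ γ) ∷ (β ⟹ δ) ∷ S)
  ∨-left : ∀ {β γ δ S} → ((β ⟹ γ ∨⁺ δ) ∷ S) ⇛ ((β ∧⁺ ¬⁺ γ ⟹ δ) ∷ S)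
  ∨-left⁻¹ : ∀ {β γ δ S} → ((β ∧⁺ ¬⁺ γ ⟹ δ) ∷ S) ⇛ ((β ⟹ γ ∨⁺ δ) ∷ S)
  □-left : ∀ {γ δ S} → ((γ ⟹ □⁺ δ) ∷ S) ⇛ ((◇⁻ γ ⟹ δ) ∷ S)
  □-left⁻¹ : ∀ {γ δ S} → ((◇⁻ γ ⟹ δ) ∷ S) ⇛ ((γ ⟹ □⁺ δ) ∷ S)
  ◇-rule : ∀ {j k γ S} → k ≢ 0 →
           All (λ e → hasNom k (eqFm e) ≡ false) ((nom j ⟹ ◇⁺ γ) ∷ S) →
           ((nom j ⟹ ◇⁺ γ) ∷ S) ⇛ ((nom j ⟹ ◇⁺ nom k) ∷ (nom k ⟹ γ) ∷ S)
  ackermann : ∀ p (αs : List Fm⁺) (βs : System) →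
           All (λ α → occurs⁺ p α ≡ false) αs →
           All (λ β → occ true p (eqFm β) ≡ false) βs →
           (map (λ α → α ⟹ var⁺ p) αs ++ βs) ⇛ map (substEq (⋁⁺ αs) p) βs
  polarity : ∀ p {S} → S ⇛ map (switchEq p) S
  simpˡ : ∀ {a a' b S} → a ↝ a' → ((a ⟹ b) ∷ S) ⇛ ((a' ⟹ b) ∷ S)
  simpʳ : ∀ {a b b' S} → b ↝ b' → ((a ⟹ b) ∷ S) ⇛ ((a ⟹ b') ∷ S)

step3 : Fm⁺ → Fm⁺
step3 α = sub σ α
  where
  σ : ℕ → Fm⁺
  σ q = if not (occ false q (𝐢 ⇒⁺ α)) then ⊤⁺
        else if not (occ true q (𝐢 ⇒⁺ α)) then ⊥⁺
        else var⁺ q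

initialSystem : Fm → System
initialSystem α = (𝐢 ⟹ step3 ⌜ α ⌝) ∷ []

NoVars : System → Set
NoVars S = All (λ e → hasVar (eqFm e) ≡ false) S

SQEMASucceeds : Fm → Set
SQEMASucceeds φ = ∀ α → α ∈ disjuncts φ →
  ∃ λ S → Star _⇛_ (initialSystem α) S × NoVars S

-- A disjunct of the negation of a conjunction of monadic inductive formulae is a disjunct
-- of the negation of one conjunct ψ.  Let ≺ be the transitive closure of the dependency
-- digraph of ψ, a strict order because the digraph is acyclic.  Every such disjunct is
-- built with ∧ and ◇ from negative formulae and normal forms □…(¬A ∨ □…(¬A' ∨ … p)) of
-- box-formulae in which every variable of an antecedent A is ≺ the head p; step (3)
-- keeps this shape.  The ∧-, ◇-, □- and ∨-rules therefore decompose {i → α} into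
-- equations that are either negative or of the form α → p with α positive and all its
-- variables ≺ p.  Any variable p can then be eliminated by the Ackermann-rule: the
-- equations α → p are exactly those containing p positively, and substituting the
-- (positive) disjunction of their α's into the other equations preserves the invariant,
-- by transitivity of ≺ and because irreflexivity keeps p out of the α's.  Eliminating
-- the variables one after another leaves a system without propositional variables.
module Submission where

open import Defs
open import Data.Bool using (Bool; true; false; not; _∨_; if_then_else_)
open import Data.Bool.Properties using (∨-conicalˡ; ∨-conicalʳ; ∨-zeroʳ; ∨-assoc; not-involutive; ¬-not; not-¬; T-≡)
open import Data.Empty using (⊥-elim)
open import Data.List using (List; []; _∷_; map; _++_; concatMap)
open import Data.List.Membership.Propositional using (_∈_; find; lose)
open import Data.List.Membership.Propositional.Properties using (∈-++⁺ˡ; ∈-++⁺ʳ; ∈-++⁻; ∈-map⁻; ∈-concatMap⁺; ∈-concatMap⁻)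
open import Data.List.Properties using (++-assoc)
open import Data.List.Relation.Unary.All as All using (All; []; _∷_; lookupAny)
open import Data.List.Relation.Unary.All.Properties using (++⁺; ++⁻; map⁺; map⁻)
open import Data.List.Relation.Unary.Any using (Any; here; there)
open import Data.List.Relation.Unary.Any.Properties using (¬Any[])
open import Data.List.Relation.Binary.Permutation.Propositional using (_↭_; ↭-refl; ↭-sym; ↭-trans; prep; swap)
open import Data.List.Relation.Binary.Permutation.Propositional.Properties using (shift; ∈-resp-↭; All-resp-↭)
open import Data.Nat using (ℕ; suc; _≡ᵇ_; _<_; _≟_)
open import Data.Nat.Properties using (≡ᵇ⇒≡; ≡⇒≡ᵇ; <-trans; <-irrefl; n<1+n)
open import Data.Product as Product using (∃; ∃₂; _×_; _,_; proj₁; proj₂; uncurry)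
open import Data.Sum using (_⊎_; inj₁; inj₂; [_,_]′)
open import Function using (_∘_; id)
open import Function.Bundles using (Equivalence)
open import Level using (0ℓ)
open import Relation.Binary.Core using (Rel; _⇒_)
open import Relation.Binary.Structures using (IsStrictPartialOrder)
open import Relation.Binary.PropositionalEquality using (_≡_; _≢_; refl; sym; trans; cong₂; subst; isEquivalence; resp₂)
open import Relation.Binary.Construct.Closure.Transitive using (TransClosure; [_]; transitive)
open import Relation.Binary.Construct.Closure.ReflexiveTransitive using (Star; ε; _◅_; _◅◅_)
open import Relation.Nullary using (¬_; yes; no)
open import Relation.Unary using (_∩_)

∨-≡true⁻ : ∀ x {y} → x ∨ y ≡ true → x ≡ true ⊎ y ≡ true
∨-≡true⁻ true  _ = inj₁ refl
∨-≡true⁻ false e = inj₂ e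

∨-≡trueˡ : ∀ {x} y → x ≡ true → x ∨ y ≡ true
∨-≡trueˡ _ refl = refl

∨-≡trueʳ : ∀ x {y} → y ≡ true → x ∨ y ≡ true
∨-≡trueʳ x refl = ∨-zeroʳ x

∨-≡false⁻ : ∀ x {y} → x ∨ y ≡ false → x ≡ false × y ≡ false
∨-≡false⁻ x e = ∨-conicalˡ x _ e , ∨-conicalʳ x _ e

∨-mono-≡true : ∀ {x y x' y'} → (x ≡ true → x' ≡ true) → (y ≡ true → y' ≡ true) →
               x ∨ y ≡ true → x' ∨ y' ≡ true
∨-mono-≡true {true}  f g _ = ∨-≡trueˡ _ (f refl)
∨-mono-≡true {false} f g e = ∨-≡trueʳ _ (g e)

≡ᵇ-refl : ∀ n → (n ≡ᵇ n) ≡ true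
≡ᵇ-refl n = Equivalence.to T-≡ (≡⇒≡ᵇ n n refl)

≡ᵇ-true⇒≡ : ∀ m n → (m ≡ᵇ n) ≡ true → m ≡ n
≡ᵇ-true⇒≡ m n e = ≡ᵇ⇒≡ m n (Equivalence.from T-≡ e)

≢⇒≡ᵇ-false : ∀ {m n} → m ≢ n → (m ≡ᵇ n) ≡ false
≢⇒≡ᵇ-false m≢n = ¬-not (m≢n ∘ ≡ᵇ-true⇒≡ _ _)

∈-∷⁻-≢ : ∀ {v p : ℕ} {Vs} → v ∈ p ∷ Vs → v ≢ p → v ∈ Vs
∈-∷⁻-≢ (here v≡p) v≢p = ⊥-elim (v≢p v≡p)
∈-∷⁻-≢ (there v∈) _   = v∈

-- Occurrences of variables

Occurs : ℕ → Fm⁺ → Set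
Occurs v x = ∃ λ b → occ b v x ≡ true

AllVars : (ℕ → Set) → Fm⁺ → Set
AllVars P x = ∀ {v} → Occurs v x → P v

NoOcc : Bool → Fm⁺ → Set
NoOcc b x = ∀ v → occ b v x ≡ false

Positive⁺ Negative⁺ : Fm⁺ → Set
Positive⁺ = NoOcc false
Negative⁺ = NoOcc true

Occurs⇒occurs⁺ : ∀ {v x} → Occurs v x → occurs⁺ v x ≡ true
Occurs⇒occurs⁺ (true , o)              = ∨-≡trueˡ _ o
Occurs⇒occurs⁺ {v} {x} (false , o) = ∨-≡trueʳ (occ true v x) o

¬Occurs⇒occurs⁺-false : ∀ {v x} → ¬ Occurs v x → occurs⁺ v x ≡ false
¬Occurs⇒occurs⁺-false {v} {x} ∄o =
  ¬-not λ o → ∄o ([ (true ,_) , (false ,_) ]′ (∨-≡true⁻ (occ true v x) o))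

Occurs-¬ : ∀ {v a} → Occurs v a → Occurs v (¬⁺ a)
Occurs-¬ (true , o)  = false , o
Occurs-¬ (false , o) = true , o

Occurs-either : ∀ {v a c} → Occurs v a ⊎ Occurs v c → ∃ λ b → occ b v a ∨ occ b v c ≡ true
Occurs-either {c = c} (inj₁ (b , o)) = b , ∨-≡trueˡ (occ b _ c) o
Occurs-either {a = a} (inj₂ (b , o)) = b , ∨-≡trueʳ (occ b _ a) o

Occurs-⇒ˡ : ∀ {v a c} → Occurs v a → Occurs v (a ⇒⁺ c)
Occurs-⇒ˡ {a = a} {c} o = Occurs-either {a = ¬⁺ a} {c} (inj₁ (Occurs-¬ {a = a} o))

hasVar⇒Occurs : ∀ x → hasVar x ≡ true → ∃ λ v → Occurs v x
hasVar⇒Occurs (var⁺ q) _ = q , true , ≡ᵇ-refl q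
hasVar⇒Occurs (¬⁺ a) h = Product.map₂ (Occurs-¬ {a = a}) (hasVar⇒Occurs a h)
hasVar⇒Occurs (a ∧⁺ c) h with ∨-≡true⁻ (hasVar a) h
... | inj₁ ha = Product.map₂ (Occurs-either {a = a} {c} ∘ inj₁) (hasVar⇒Occurs a ha)
... | inj₂ hc = Product.map₂ (Occurs-either {a = a} {c} ∘ inj₂) (hasVar⇒Occurs c hc)
hasVar⇒Occurs (a ∨⁺ c) h with ∨-≡true⁻ (hasVar a) h
... | inj₁ ha = Product.map₂ (Occurs-either {a = a} {c} ∘ inj₁) (hasVar⇒Occurs a ha)
... | inj₂ hc = Product.map₂ (Occurs-either {a = a} {c} ∘ inj₂) (hasVar⇒Occurs c hc)
hasVar⇒Occurs (a ⇒⁺ c) h with ∨-≡true⁻ (hasVar a) h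
... | inj₁ ha = Product.map₂ (Occurs-⇒ˡ {a = a} {c}) (hasVar⇒Occurs a ha)
... | inj₂ hc = Product.map₂ (Occurs-either {a = ¬⁺ a} {c} ∘ inj₂) (hasVar⇒Occurs c hc)
hasVar⇒Occurs (◇⁺ a) h = hasVar⇒Occurs a h
hasVar⇒Occurs (□⁺ a) h = hasVar⇒Occurs a h
hasVar⇒Occurs (◇⁻ a) h = hasVar⇒Occurs a h
hasVar⇒Occurs (□⁻ a) h = hasVar⇒Occurs a h

AllVars-[]⇒hasVar-false : ∀ {x} → AllVars (_∈ []) x → hasVar x ≡ false
AllVars-[]⇒hasVar-false {x} x∈[] = ¬-not λ h → ¬Any[] (x∈[] (proj₂ (hasVar⇒Occurs x h)))

vars : Fm⁺ → List ℕ
vars ⊤⁺ = []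
vars ⊥⁺ = []
vars (var⁺ q) = q ∷ []
vars (nom _) = []
vars (¬⁺ a) = vars a
vars (a ∧⁺ c) = vars a ++ vars c
vars (a ∨⁺ c) = vars a ++ vars c
vars (a ⇒⁺ c) = vars a ++ vars c
vars (◇⁺ a) = vars a
vars (□⁺ a) = vars a
vars (◇⁻ a) = vars a
vars (□⁻ a) = vars a

occ⇒∈vars : ∀ b v x → occ b v x ≡ true → v ∈ vars x
occ⇒∈vars true v (var⁺ q) o = here (sym (≡ᵇ-true⇒≡ q v o))
occ⇒∈vars b v (¬⁺ a) o = occ⇒∈vars (not b) v a o
occ⇒∈vars b v (a ∧⁺ c) o =
  [ ∈-++⁺ˡ ∘ occ⇒∈vars b v a , ∈-++⁺ʳ (vars a) ∘ occ⇒∈vars b v c ]′ (∨-≡true⁻ _ o)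
occ⇒∈vars b v (a ∨⁺ c) o =
  [ ∈-++⁺ˡ ∘ occ⇒∈vars b v a , ∈-++⁺ʳ (vars a) ∘ occ⇒∈vars b v c ]′ (∨-≡true⁻ _ o)
occ⇒∈vars b v (a ⇒⁺ c) o =
  [ ∈-++⁺ˡ ∘ occ⇒∈vars (not b) v a , ∈-++⁺ʳ (vars a) ∘ occ⇒∈vars b v c ]′ (∨-≡true⁻ _ o)
occ⇒∈vars b v (◇⁺ a) o = occ⇒∈vars b v a o
occ⇒∈vars b v (□⁺ a) o = occ⇒∈vars b v a o
occ⇒∈vars b v (◇⁻ a) o = occ⇒∈vars b v a o
occ⇒∈vars b v (□⁻ a) o = occ⇒∈vars b v a o

allVars : System → List ℕ
allVars = concatMap (vars ∘ eqFm)

AllVars-allVars : ∀ S → All (AllVars (_∈ allVars S) ∘ eqFm) S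
AllVars-allVars S =
  All.tabulate λ {e} e∈S (b , o) → ∈-concatMap⁺ (vars ∘ eqFm) (lose e∈S (occ⇒∈vars b _ (eqFm e) o))

occ-⋁⁺ : ∀ xs {b v} → occ b v (⋁⁺ xs) ≡ true → Any (λ x → occ b v x ≡ true) xs
occ-⋁⁺ (x ∷ [])     o = here o
occ-⋁⁺ (x ∷ y ∷ xs) o = [ here , there ∘ occ-⋁⁺ (y ∷ xs) ]′ (∨-≡true⁻ _ o)

NoOcc-⋁⁺ : ∀ {b xs} → All (NoOcc b) xs → NoOcc b (⋁⁺ xs)
NoOcc-⋁⁺ {xs = xs} xs-b v = ¬-not λ o → let x-b , o′ = lookupAny xs-b (occ-⋁⁺ xs o) in not-¬ o′ (x-b v)

AllVars-⋁⁺ : ∀ {P xs} → All (AllVars P) xs → AllVars P (⋁⁺ xs)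
AllVars-⋁⁺ {xs = xs} xs-P (b , o) = let x-P , o′ = lookupAny xs-P (occ-⋁⁺ xs o) in x-P (b , o′)

-- Substitution

data OccursVia (σ : ℕ → Fm⁺) (b : Bool) (v : ℕ) (x : Fm⁺) : Set where
  via-positive : ∀ q → occ b q x ≡ true → occ true v (σ q) ≡ true → OccursVia σ b v x
  via-negative : ∀ q → occ (not b) q x ≡ true → occ false v (σ q) ≡ true → OccursVia σ b v x

OccursVia-map : ∀ {σ b v x} y → (∀ {c q} → occ c q x ≡ true → occ c q y ≡ true) →
                OccursVia σ b v x → OccursVia σ b v y
OccursVia-map _ f (via-positive q o t) = via-positive q (f o) t
OccursVia-map _ f (via-negative q o t) = via-negative q (f o) t

OccursVia-flip : ∀ {σ b v x} y → (∀ {c q} → occ (not c) q x ≡ true → occ c q y ≡ true) →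
                 OccursVia σ (not b) v x → OccursVia σ b v y
OccursVia-flip _ f (via-positive q o t) = via-positive q (f o) t
OccursVia-flip _ f (via-negative q o t) = via-negative q (f o) t

occ-sub⁻ : ∀ σ b v x → occ b v (sub σ x) ≡ true → OccursVia σ b v x
occ-sub⁻ σ true  v (var⁺ q) o = via-positive q (≡ᵇ-refl q) o
occ-sub⁻ σ false v (var⁺ q) o = via-negative q (≡ᵇ-refl q) o
occ-sub⁻ σ b v (¬⁺ a) o = OccursVia-flip (¬⁺ a) id (occ-sub⁻ σ (not b) v a o)
occ-sub⁻ σ b v (a ∧⁺ c) o with ∨-≡true⁻ (occ b v (sub σ a)) o
... | inj₁ oa = OccursVia-map (a ∧⁺ c) (∨-≡trueˡ _) (occ-sub⁻ σ b v a oa)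
... | inj₂ oc = OccursVia-map (a ∧⁺ c) (∨-≡trueʳ _) (occ-sub⁻ σ b v c oc)
occ-sub⁻ σ b v (a ∨⁺ c) o with ∨-≡true⁻ (occ b v (sub σ a)) o
... | inj₁ oa = OccursVia-map (a ∨⁺ c) (∨-≡trueˡ _) (occ-sub⁻ σ b v a oa)
... | inj₂ oc = OccursVia-map (a ∨⁺ c) (∨-≡trueʳ _) (occ-sub⁻ σ b v c oc)
occ-sub⁻ σ b v (a ⇒⁺ c) o with ∨-≡true⁻ (occ (not b) v (sub σ a)) o
... | inj₁ oa = OccursVia-flip (a ⇒⁺ c) (∨-≡trueˡ _) (occ-sub⁻ σ (not b) v a oa)
... | inj₂ oc = OccursVia-map (a ⇒⁺ c) (∨-≡trueʳ _) (occ-sub⁻ σ b v c oc)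
occ-sub⁻ σ b v (◇⁺ a) o = OccursVia-map (◇⁺ a) id (occ-sub⁻ σ b v a o)
occ-sub⁻ σ b v (□⁺ a) o = OccursVia-map (□⁺ a) id (occ-sub⁻ σ b v a o)
occ-sub⁻ σ b v (◇⁻ a) o = OccursVia-map (◇⁻ a) id (occ-sub⁻ σ b v a o)
occ-sub⁻ σ b v (□⁻ a) o = OccursVia-map (□⁻ a) id (occ-sub⁻ σ b v a o)

occ-[/]⁻ : ∀ {γ p b v} x → occ b v (x [ γ / p ]) ≡ true →
           (occ b v x ≡ true × v ≢ p)
           ⊎ (occ b p x ≡ true × occ true v γ ≡ true)
           ⊎ (occ (not b) p x ≡ true × occ false v γ ≡ true)
occ-[/]⁻ {γ} {p} {b} {v} x o with occ-sub⁻ (λ q → if q ≡ᵇ p then γ else var⁺ q) b v x o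
... | via-positive q oq t with q ≡ᵇ p in q≡ᵇp
...   | true with ≡ᵇ-true⇒≡ q p q≡ᵇp
...     | refl = inj₂ (inj₁ (oq , t))
occ-[/]⁻ x o | via-positive q oq t | false with ≡ᵇ-true⇒≡ q _ t
...     | refl = inj₁ (oq , λ { refl → not-¬ (≡ᵇ-refl q) q≡ᵇp })
occ-[/]⁻ {p = p} x o | via-negative q oq f with q ≡ᵇ p in q≡ᵇp
...   | true with ≡ᵇ-true⇒≡ q p q≡ᵇp
...     | refl = inj₂ (inj₂ (oq , f))
occ-[/]⁻ x o | via-negative q oq () | false

Occurs-[/]⁻ : ∀ {γ p v} x → Occurs v (x [ γ / p ]) → (Occurs v x × v ≢ p) ⊎ (Occurs p x × Occurs v γ)
Occurs-[/]⁻ x (b , o) with occ-[/]⁻ x o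
... | inj₁ (o′ , v≢p)         = inj₁ ((b , o′) , v≢p)
... | inj₂ (inj₁ (op , oγ)) = inj₂ ((b , op) , (true , oγ))
... | inj₂ (inj₂ (op , oγ)) = inj₂ ((not b , op) , (false , oγ))

NoOcc-[/] : ∀ {b γ p} x → NoOcc b x → Positive⁺ γ → NoOcc b (x [ γ / p ])
NoOcc-[/] {p = p} x x-b γ⁺ v = ¬-not λ o → excluded (occ-[/]⁻ x o)
  where
  excluded : _ → _
  excluded (inj₁ (o , _))         = not-¬ o (x-b v)
  excluded (inj₂ (inj₁ (o , _))) = not-¬ o (x-b p)
  excluded (inj₂ (inj₂ (_ , o))) = not-¬ o (γ⁺ v)

AllVars-[/] : ∀ {P Q : ℕ → Set} {γ p} x → AllVars P x → (∀ {v} → P v → v ≢ p → Q v) →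
              (P p → AllVars Q γ) → AllVars Q (x [ γ / p ])
AllVars-[/] x x-P P⇒Q γ-Q o with Occurs-[/]⁻ x o
... | inj₁ (o′ , v≢p) = P⇒Q (x-P o′) v≢p
... | inj₂ (op , oγ)  = γ-Q (x-P op) oγ

data VarOrConst (q : ℕ) : Fm⁺ → Set where
  const⊤ : VarOrConst q ⊤⁺
  const⊥ : VarOrConst q ⊥⁺
  itself : VarOrConst q (var⁺ q)

occ-VarOrConst : ∀ {q s b v} → VarOrConst q s → occ b v s ≡ true → b ≡ true × q ≡ v
occ-VarOrConst {b = true} itself o = refl , ≡ᵇ-true⇒≡ _ _ o

hasNom-VarOrConst : ∀ {q s m} → VarOrConst q s → hasNom m s ≡ false
hasNom-VarOrConst const⊤ = refl
hasNom-VarOrConst const⊥ = refl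
hasNom-VarOrConst itself = refl

module _ {σ : ℕ → Fm⁺} (σ-triv : ∀ q → VarOrConst q (σ q)) where

  occ-sub-VarOrConst : ∀ {b v} x → occ b v (sub σ x) ≡ true → occ b v x ≡ true
  occ-sub-VarOrConst {b} {v} x o with occ-sub⁻ σ b v x o
  ... | via-positive q oq t with occ-VarOrConst (σ-triv q) t
  ...   | _ , refl = oq
  occ-sub-VarOrConst x o | via-negative q _ f with occ-VarOrConst (σ-triv q) f
  ...   | () , _

  NoOcc-sub : ∀ {b} x → NoOcc b x → NoOcc b (sub σ x)
  NoOcc-sub x x-b v = ¬-not λ o → not-¬ (occ-sub-VarOrConst x o) (x-b v)

  AllVars-sub : ∀ {P} x → AllVars P x → AllVars P (sub σ x)
  AllVars-sub x x-P (b , o) = x-P (b , occ-sub-VarOrConst x o)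

  hasNom-sub-⌜⌝ : ∀ {m} x → hasNom m (sub σ ⌜ x ⌝) ≡ false
  hasNom-sub-⌜⌝ ⊤ₘ = refl
  hasNom-sub-⌜⌝ ⊥ₘ = refl
  hasNom-sub-⌜⌝ (var q) = hasNom-VarOrConst (σ-triv q)
  hasNom-sub-⌜⌝ (¬ₘ a) = hasNom-sub-⌜⌝ a
  hasNom-sub-⌜⌝ (a ∧ₘ c) = cong₂ _∨_ (hasNom-sub-⌜⌝ a) (hasNom-sub-⌜⌝ c)
  hasNom-sub-⌜⌝ (a ∨ₘ c) = cong₂ _∨_ (hasNom-sub-⌜⌝ a) (hasNom-sub-⌜⌝ c)
  hasNom-sub-⌜⌝ (a ⇒ₘ c) = cong₂ _∨_ (hasNom-sub-⌜⌝ a) (hasNom-sub-⌜⌝ c)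
  hasNom-sub-⌜⌝ (◇ₘ a) = hasNom-sub-⌜⌝ a
  hasNom-sub-⌜⌝ (□ₘ a) = hasNom-sub-⌜⌝ a

-- The σ of step3, so that step3 α = sub (step3-subst α) α holds by definition.
step3-subst : Fm⁺ → ℕ → Fm⁺
step3-subst α q = if not (occ false q (𝐢 ⇒⁺ α)) then ⊤⁺
                  else if not (occ true q (𝐢 ⇒⁺ α)) then ⊥⁺
                  else var⁺ q

step3-subst-VarOrConst : ∀ α q → VarOrConst q (step3-subst α q)
step3-subst-VarOrConst α q with occ false q (𝐢 ⇒⁺ α) | occ true q (𝐢 ⇒⁺ α)
... | false | _     = const⊤
... | true  | false = const⊥
... | true  | true  = itself

-- Negation normal form and distribution

occ-not-not : ∀ b v x → occ b v x ≡ true → occ (not (not b)) v x ≡ true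
occ-not-not b v x = subst (λ c → occ c v x ≡ true) (sym (not-involutive b))

occ-nnf-true  : ∀ x {b v} → occ b v ⌜ nnf true x ⌝ ≡ true → occ b v ⌜ x ⌝ ≡ true
occ-nnf-false : ∀ x {b v} → occ b v ⌜ nnf false x ⌝ ≡ true → occ (not b) v ⌜ x ⌝ ≡ true
occ-nnf-true (var _) o = o
occ-nnf-true (¬ₘ a) o = occ-nnf-false a o
occ-nnf-true (a ∧ₘ c) = ∨-mono-≡true (occ-nnf-true a) (occ-nnf-true c)
occ-nnf-true (a ∨ₘ c) = ∨-mono-≡true (occ-nnf-true a) (occ-nnf-true c)
occ-nnf-true (a ⇒ₘ c) = ∨-mono-≡true (occ-nnf-false a) (occ-nnf-true c)
occ-nnf-true (◇ₘ a) = occ-nnf-true a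
occ-nnf-true (□ₘ a) = occ-nnf-true a
occ-nnf-false (var _) o = o
occ-nnf-false (¬ₘ a) {b} {v} = occ-not-not b v ⌜ a ⌝ ∘ occ-nnf-true a
occ-nnf-false (a ∧ₘ c) = ∨-mono-≡true (occ-nnf-false a) (occ-nnf-false c)
occ-nnf-false (a ∨ₘ c) = ∨-mono-≡true (occ-nnf-false a) (occ-nnf-false c)
occ-nnf-false (a ⇒ₘ c) {b} {v} = ∨-mono-≡true (occ-not-not b v ⌜ a ⌝ ∘ occ-nnf-true a) (occ-nnf-false c)
occ-nnf-false (◇ₘ a) = occ-nnf-false a
occ-nnf-false (□ₘ a) = occ-nnf-false a

∈-dist-∧⁻ : ∀ a c {y} → y ∈ dist (a ∧ₘ c) → ∃₂ λ x z → x ∈ dist a × z ∈ dist c × y ≡ x ∧ₘ z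
∈-dist-∧⁻ a c y∈ with find (∈-concatMap⁻ (λ x → map (x ∧ₘ_) (dist c)) {xs = dist a} y∈)
... | x , x∈ , y∈xc with ∈-map⁻ (x ∧ₘ_) y∈xc
...   | z , z∈ , refl = x , z , x∈ , z∈ , refl

occ-⋁ₘ : ∀ xs {b v} → occ b v ⌜ ⋁ₘ xs ⌝ ≡ true → Any (λ x → occ b v ⌜ x ⌝ ≡ true) xs
occ-⋁ₘ (x ∷ [])     o = here o
occ-⋁ₘ (x ∷ y ∷ xs) o = [ here , there ∘ occ-⋁ₘ (y ∷ xs) ]′ (∨-≡true⁻ _ o)

occ-dist : ∀ x {y b v} → y ∈ dist x → occ b v ⌜ y ⌝ ≡ true → occ b v ⌜ x ⌝ ≡ true
occ-dist ⊤ₘ (here refl) o = o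
occ-dist ⊥ₘ (here refl) o = o
occ-dist (var _) (here refl) o = o
occ-dist (¬ₘ _) (here refl) o = o
occ-dist (_ ⇒ₘ _) (here refl) o = o
occ-dist (a ∨ₘ c) y∈ o with ∈-++⁻ (dist a) y∈
... | inj₁ y∈a = ∨-≡trueˡ _ (occ-dist a y∈a o)
... | inj₂ y∈c = ∨-≡trueʳ _ (occ-dist c y∈c o)
occ-dist (a ∧ₘ c) y∈ o with ∈-dist-∧⁻ a c y∈
... | x , z , x∈ , z∈ , refl = ∨-mono-≡true (occ-dist a x∈) (occ-dist c z∈) o
occ-dist (◇ₘ a) y∈ o with ∈-map⁻ ◇ₘ_ y∈
... | z , z∈ , refl = occ-dist a z∈ o
occ-dist (□ₘ a) (here refl) o with find (occ-⋁ₘ (dist a) o)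
... | z , z∈ , oz = occ-dist a z∈ oz

occ-negation-disjunct : ∀ A {y b v} → y ∈ dist (nnf false A) → occ b v ⌜ y ⌝ ≡ true →
                        occ (not b) v ⌜ A ⌝ ≡ true
occ-negation-disjunct A y∈ = occ-nnf-false A ∘ occ-dist (nnf false A) y∈

negation-disjunct-Negative⁺ : ∀ {A y} → Positive A → y ∈ dist (nnf false A) → Negative⁺ ⌜ y ⌝
negation-disjunct-Negative⁺ {A} (positive A⁺) y∈ v =
  ¬-not λ o → not-¬ (occ-negation-disjunct A y∈ o) (A⁺ v)

Edge-mono : ∀ {ψ φ} → (∀ {B} → B ⊑ ψ → B ⊑ φ) → Edge ψ ⇒ Edge φ
Edge-mono f (B , B⊑ψ , b , i) = B , f B⊑ψ , b , i

module Shapes (_≺_ : Rel ℕ 0ℓ) where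

  -- A box-formula B(p) in negation normal form, antecedents becoming negative disjuncts
  -- whose variables are ≺ p; `neg` also covers a head that step (3) replaced by ⊤ or ⊥.
  data BoxForm⁺ (p : ℕ) : Fm⁺ → Set where
    head : BoxForm⁺ p (var⁺ p)
    neg  : ∀ {d} → Negative⁺ d → BoxForm⁺ p d
    box  : ∀ {d} → BoxForm⁺ p d → BoxForm⁺ p (□⁺ d)
    or   : ∀ {n d} → Negative⁺ n → AllVars (_≺ p) n → BoxForm⁺ p d → BoxForm⁺ p (n ∨⁺ d)

  data InductiveDisjunct : Fm⁺ → Set where
    neg         : ∀ {n} → Negative⁺ n → InductiveDisjunct n
    and         : ∀ {a c} → InductiveDisjunct a → InductiveDisjunct c → InductiveDisjunct (a ∧⁺ c)
    dia         : ∀ {a} → InductiveDisjunct a → InductiveDisjunct (◇⁺ a)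
    box-formula : ∀ {d} p → BoxForm⁺ p d → InductiveDisjunct d

  data Admissible : Eqn → Set where
    negative : ∀ {e} → Negative⁺ (eqFm e) → Admissible e
    defining : ∀ {α p} → Positive⁺ α → AllVars (_≺ p) α → Admissible (α ⟹ var⁺ p)

  negation-disjunct-AllVars : ∀ {A p y} → (∀ {v} → occurs v A ≡ true → v ≺ p) →
                              y ∈ dist (nnf false A) → AllVars (_≺ p) ⌜ y ⌝
  negation-disjunct-AllVars {A} A≺p y∈ {v} (b , o) =
    A≺p (Occurs⇒occurs⁺ {v} {⌜ A ⌝} (not b , occ-negation-disjunct A {b = b} {v} y∈ o))

  ⋁ₘ-BoxForm⁺ : ∀ {p} xs {ys} → All (λ x → Negative⁺ ⌜ x ⌝ × AllVars (_≺ p) ⌜ x ⌝) xs →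
                BoxForm⁺ p ⌜ ⋁ₘ ys ⌝ → BoxForm⁺ p ⌜ ⋁ₘ (xs ++ ys) ⌝
  ⋁ₘ-BoxForm⁺ [] [] d = d
  ⋁ₘ-BoxForm⁺ (x ∷ []) {[]} ((x⁻ , _) ∷ []) _ = neg x⁻
  ⋁ₘ-BoxForm⁺ (x ∷ []) {_ ∷ _} ((x⁻ , x≺) ∷ []) d = or x⁻ x≺ d
  ⋁ₘ-BoxForm⁺ (x ∷ x′ ∷ xs) ((x⁻ , x≺) ∷ xs-ok) d = or x⁻ x≺ (⋁ₘ-BoxForm⁺ (x′ ∷ xs) xs-ok d)

  IsBox-BoxForm⁺ : ∀ {p B} (b : IsBox p B) → (∀ {q} → Inessential q b → q ≺ p) →
                   BoxForm⁺ p ⌜ ⋁ₘ (dist (nnf true B)) ⌝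
  IsBox-BoxForm⁺ bvar _ = head
  IsBox-BoxForm⁺ (bbox b) ess = box (IsBox-BoxForm⁺ b (ess ∘ ibox))
  IsBox-BoxForm⁺ (bimp {A} A⁺ b) ess =
    ⋁ₘ-BoxForm⁺ (dist (nnf false A))
      (All.tabulate λ y∈ → negation-disjunct-Negative⁺ A⁺ y∈
                         , negation-disjunct-AllVars {A} (ess ∘ ihere) y∈)
      (IsBox-BoxForm⁺ b (ess ∘ ithere))

  IsBox-disjunct : ∀ {p B y} (b : IsBox p B) → (∀ {q} → Inessential q b → q ≺ p) →
                   y ∈ dist (nnf true B) → InductiveDisjunct ⌜ y ⌝
  IsBox-disjunct bvar _ (here refl) = box-formula _ head
  IsBox-disjunct (bbox b) ess (here refl) = box-formula _ (box (IsBox-BoxForm⁺ b (ess ∘ ibox)))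
  IsBox-disjunct (bimp {A} A⁺ b) ess y∈ with ∈-++⁻ (dist (nnf false A)) y∈
  ... | inj₁ y∈A = neg (negation-disjunct-Negative⁺ A⁺ y∈A)
  ... | inj₂ y∈B = IsBox-disjunct b (ess ∘ ithere) y∈B

  Regular-disjunct : ∀ {ψ y} → Regular ψ → Edge ψ ⇒ _≺_ → y ∈ dist (nnf false ψ) →
                     InductiveDisjunct ⌜ y ⌝
  Regular-disjunct r⊤ _ (here refl) = neg λ _ → refl
  Regular-disjunct r⊥ _ (here refl) = neg λ _ → refl
  Regular-disjunct (rpos A⁺) _ y∈ = neg (negation-disjunct-Negative⁺ A⁺ y∈)
  Regular-disjunct (rneg b) edge y∈ = IsBox-disjunct b (λ i → edge (_ , ⊑¬ ⊑refl , b , i)) y∈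
  Regular-disjunct (r∧ {a} ra rc) edge y∈ with ∈-++⁻ (dist (nnf false a)) y∈
  ... | inj₁ y∈a = Regular-disjunct ra (edge ∘ Edge-mono ⊑∧ˡ) y∈a
  ... | inj₂ y∈c = Regular-disjunct rc (edge ∘ Edge-mono ⊑∧ʳ) y∈c
  Regular-disjunct (r∨ {a} {c} ra rc) edge y∈ with ∈-dist-∧⁻ (nnf false a) (nnf false c) y∈
  ... | x , z , x∈ , z∈ , refl =
    and (Regular-disjunct ra (edge ∘ Edge-mono ⊑∨ˡ) x∈) (Regular-disjunct rc (edge ∘ Edge-mono ⊑∨ʳ) z∈)
  Regular-disjunct (r□ ra) edge y∈ with ∈-map⁻ ◇ₘ_ y∈
  ... | z , z∈ , refl = dia (Regular-disjunct ra (edge ∘ Edge-mono ⊑□) z∈)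

  module _ {σ : ℕ → Fm⁺} (σ-triv : ∀ q → VarOrConst q (σ q)) where

    VarOrConst-BoxForm⁺ : ∀ {p s} → VarOrConst p s → BoxForm⁺ p s
    VarOrConst-BoxForm⁺ const⊤ = neg λ _ → refl
    VarOrConst-BoxForm⁺ const⊥ = neg λ _ → refl
    VarOrConst-BoxForm⁺ itself = head

    BoxForm⁺-sub : ∀ {p d} → BoxForm⁺ p d → BoxForm⁺ p (sub σ d)
    BoxForm⁺-sub {p} head = VarOrConst-BoxForm⁺ (σ-triv p)
    BoxForm⁺-sub {d = d} (neg d⁻) = neg (NoOcc-sub σ-triv d d⁻)
    BoxForm⁺-sub (box d) = box (BoxForm⁺-sub d)
    BoxForm⁺-sub (or {n} n⁻ n≺ d) =
      or (NoOcc-sub σ-triv n n⁻) (AllVars-sub σ-triv n n≺) (BoxForm⁺-sub d)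

    InductiveDisjunct-sub : ∀ {t} → InductiveDisjunct t → InductiveDisjunct (sub σ t)
    InductiveDisjunct-sub {t} (neg t⁻) = neg (NoOcc-sub σ-triv t t⁻)
    InductiveDisjunct-sub (and ta tc) = and (InductiveDisjunct-sub ta) (InductiveDisjunct-sub tc)
    InductiveDisjunct-sub (dia ta) = dia (InductiveDisjunct-sub ta)
    InductiveDisjunct-sub (box-formula p d) = box-formula p (BoxForm⁺-sub d)

infix 3 _⇛⋆_
_⇛⋆_ : System → System → Set
_⇛⋆_ = Star _⇛_

permute : ∀ {S S'} → S ↭ S' → S ⇛ S'
permute π = set (∈-resp-↭ π) (∈-resp-↭ (↭-sym π))

NomsAtMost : ℕ → Fm⁺ → Set
NomsAtMost N x = ∀ m → N < m → hasNom m x ≡ false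

NomsAtMost-suc : ∀ {N x} → NomsAtMost N x → NomsAtMost (suc N) x
NomsAtMost-suc fresh m N<m = fresh m (<-trans (n<1+n _) N<m)

initial-NomsAtMost : ∀ α → NomsAtMost 0 (𝐢 ⇒⁺ step3 ⌜ α ⌝)
initial-NomsAtMost α (suc _) _ = hasNom-sub-⌜⌝ (step3-subst-VarOrConst ⌜ α ⌝) α

module Decompose (_≺_ : Rel ℕ 0ℓ) where
  open Shapes _≺_

  decompose-BoxForm⁺ : ∀ {p X d R N} → BoxForm⁺ p d → Positive⁺ X → AllVars (_≺ p) X →
                       NomsAtMost N (X ⇒⁺ d) →
                       ∃ λ e → (X ⟹ d) ∷ R ⇛⋆ e ∷ R × Admissible e × NomsAtMost N (eqFm e)
  decompose-BoxForm⁺ head X⁺ X≺ fresh = _ , ε , defining X⁺ X≺ , fresh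
  decompose-BoxForm⁺ (neg d⁻) X⁺ _ fresh = _ , ε , negative (λ v → cong₂ _∨_ (X⁺ v) (d⁻ v)) , fresh
  decompose-BoxForm⁺ {X = X} (box d) X⁺ X≺ fresh =
    let e , steps , adm , fresh′ = decompose-BoxForm⁺ {X = ◇⁻ X} d X⁺ X≺ fresh
    in e , □-left ◅ steps , adm , fresh′
  decompose-BoxForm⁺ {p} {X} {N = N} (or {n} {d} n⁻ n≺ d-form) X⁺ X≺ fresh =
    let e , steps , adm , fresh′ = decompose-BoxForm⁺ {X = X ∧⁺ ¬⁺ n} d-form X¬n⁺ X¬n≺ X¬n-fresh
    in e , ∨-left ◅ steps , adm , fresh′
    where
    X¬n⁺ : Positive⁺ (X ∧⁺ ¬⁺ n)
    X¬n⁺ v = cong₂ _∨_ (X⁺ v) (n⁻ v)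
    X¬n≺ : AllVars (_≺ p) (X ∧⁺ ¬⁺ n)
    X¬n≺ (b , o) = [ (λ oX → X≺ (b , oX)) , (λ on → n≺ (not b , on)) ]′ (∨-≡true⁻ _ o)
    X¬n-fresh : NomsAtMost N ((X ∧⁺ ¬⁺ n) ⇒⁺ d)
    X¬n-fresh m N<m = trans (∨-assoc (hasNom m X) _ _) (fresh m N<m)

  record Decomposition (S R : System) : Set where
    field
      solved     : System
      bound      : ℕ
      steps      : S ⇛⋆ solved ++ R
      admissible : All Admissible solved
      fresh      : All (NomsAtMost bound ∘ eqFm) (solved ++ R)

  Decomposition-◅◅ : ∀ {S S′ R} → S ⇛⋆ S′ → Decomposition S′ R → Decomposition S R
  Decomposition-◅◅ steps′ D = record
    { solved = solved ; bound = bound ; steps = steps′ ◅◅ steps ; admissible = admissible ; fresh = fresh }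
    where open Decomposition D

  Decomposition-++ : ∀ {S R} Es → Decomposition S (Es ++ R) → All Admissible Es → Decomposition S R
  Decomposition-++ {S} {R} Es D adm = record
    { solved     = solved ++ Es
    ; bound      = bound
    ; steps      = subst (S ⇛⋆_) (sym (++-assoc solved Es R)) steps
    ; admissible = ++⁺ admissible adm
    ; fresh      = subst (All _) (sym (++-assoc solved Es R)) fresh
    }
    where open Decomposition D

  decompose : ∀ {j t R N} → InductiveDisjunct t → All (NomsAtMost N ∘ eqFm) ((nom j ⟹ t) ∷ R) →
              Decomposition ((nom j ⟹ t) ∷ R) R
  decompose {N = N} (neg t⁻) fresh =
    record { solved = _ ∷ [] ; bound = N ; steps = ε ; admissible = negative t⁻ ∷ [] ; fresh = fresh }
  decompose {j} {N = N} (box-formula p d) (fresh-t ∷ fresh-R) =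
    let e , steps , adm , fresh-e = decompose-BoxForm⁺ {X = nom j} d (λ _ → refl) (λ { (_ , ()) }) fresh-t
    in record { solved = e ∷ [] ; bound = N ; steps = steps ; admissible = adm ∷ []
              ; fresh = fresh-e ∷ fresh-R }
  decompose {j} {a ∧⁺ c} {R} {N} (and ta tc) (fresh-ac ∷ fresh-R) =
    Decomposition-◅◅ (∧-rule ◅ A.steps ◅◅ permute (shift _ A.solved R) ◅ ε)
      (Decomposition-++ A.solved (decompose tc (All-resp-↭ (shift _ A.solved R) A.fresh)) A.admissible)
    where
    j-ac-fresh : ∀ m → N < m → (j ≡ᵇ m) ≡ false × hasNom m a ≡ false × hasNom m c ≡ false
    j-ac-fresh m N<m = let j-fresh , ac-fresh = ∨-≡false⁻ (j ≡ᵇ m) (fresh-ac m N<m)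
                       in j-fresh , ∨-≡false⁻ (hasNom m a) ac-fresh
    fresh-a : NomsAtMost N (nom j ⇒⁺ a)
    fresh-a m N<m = let j-fresh , a-fresh , _ = j-ac-fresh m N<m in cong₂ _∨_ j-fresh a-fresh
    fresh-c : NomsAtMost N (nom j ⇒⁺ c)
    fresh-c m N<m = let j-fresh , _ , c-fresh = j-ac-fresh m N<m in cong₂ _∨_ j-fresh c-fresh
    module A = Decomposition (decompose {j} {R = (nom j ⟹ c) ∷ R} ta (fresh-a ∷ fresh-c ∷ fresh-R))
  decompose {j} {◇⁺ a} {R} {N} (dia ta) (fresh-◇a ∷ fresh-R) =
    Decomposition-◅◅ (◇-rule (λ ()) k-absent ◅ permute (swap _ _ ↭-refl) ◅ ε)
      (Decomposition-++ (_ ∷ []) (decompose ta (fresh-ka ∷ fresh-j◇k ∷ fresh-R′))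
                        (negative (λ _ → refl) ∷ []))
    where
    k-absent : All (λ e → hasNom (suc N) (eqFm e) ≡ false) ((nom j ⟹ ◇⁺ a) ∷ R)
    k-absent = All.map (λ fresh → fresh (suc N) (n<1+n N)) (fresh-◇a ∷ fresh-R)
    k-fresh : ∀ m → suc N < m → (suc N ≡ᵇ m) ≡ false
    k-fresh m N<m = ≢⇒≡ᵇ-false {suc N} {m} λ { refl → <-irrefl refl N<m }
    ◇a-fresh : ∀ m → suc N < m → (j ≡ᵇ m) ≡ false × hasNom m a ≡ false
    ◇a-fresh m N<m = ∨-≡false⁻ (j ≡ᵇ m) (NomsAtMost-suc {x = nom j ⇒⁺ ◇⁺ a} fresh-◇a m N<m)
    fresh-ka : NomsAtMost (suc N) (nom (suc N) ⇒⁺ a)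
    fresh-ka m N<m = cong₂ _∨_ (k-fresh m N<m) (proj₂ (◇a-fresh m N<m))
    fresh-j◇k : NomsAtMost (suc N) (nom j ⇒⁺ ◇⁺ nom (suc N))
    fresh-j◇k m N<m = cong₂ _∨_ (proj₁ (◇a-fresh m N<m)) (k-fresh m N<m)
    fresh-R′ : All (NomsAtMost (suc N) ∘ eqFm) R
    fresh-R′ = All.map (λ {e} → NomsAtMost-suc {x = eqFm e}) fresh-R

module Elimination {_≺_ : Rel ℕ 0ℓ} (≺-strict : IsStrictPartialOrder _≡_ _≺_) where
  open IsStrictPartialOrder ≺-strict using () renaming (irrefl to ≺-irrefl; trans to ≺-trans)
  open Shapes _≺_

  ≺⇒≢ : ∀ {v p} → v ≺ p → v ≢ p
  ≺⇒≢ v≺p v≡p = ≺-irrefl v≡p v≺p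

  defining-AllVars : ∀ {p Vs} α → AllVars (_≺ p) α → AllVars (_∈ p ∷ Vs) (α ⇒⁺ var⁺ p) →
                     AllVars (_∈ Vs) α
  defining-AllVars {p} α α≺ α∈ o = ∈-∷⁻-≢ (α∈ (Occurs-⇒ˡ {a = α} {var⁺ p} o)) (≺⇒≢ (α≺ o))

  Admissible-defining⁻ : ∀ {α p} → Admissible (α ⟹ var⁺ p) → (Positive⁺ ∩ AllVars (_≺ p)) α
  Admissible-defining⁻ {α} {p} (negative e⁻) =
    ⊥-elim (not-¬ (∨-≡trueʳ (occ false p α) (≡ᵇ-refl p)) (e⁻ p))
  Admissible-defining⁻ (defining α⁺ α≺) = α⁺ , α≺

  defines-or-negative-in : ∀ p {e} → Admissible e →
                           (∃ λ α → e ≡ (α ⟹ var⁺ p)) ⊎ occ true p (eqFm e) ≡ false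
  defines-or-negative-in p (negative e⁻) = inj₂ (e⁻ p)
  defines-or-negative-in p (defining {α} {q} α⁺ _) with q ≟ p
  ... | yes refl = inj₁ (α , refl)
  ... | no q≢p   = inj₂ (cong₂ _∨_ (α⁺ p) (≢⇒≡ᵇ-false q≢p))

  partition-defining : ∀ p S → All Admissible S →
                       ∃₂ λ αs βs → S ↭ map (_⟹ var⁺ p) αs ++ βs ×
                                    All (λ β → occ true p (eqFm β) ≡ false) βs
  partition-defining p [] [] = [] , [] , ↭-refl , []
  partition-defining p (e ∷ S) (adm ∷ adms) with partition-defining p S adms | defines-or-negative-in p adm
  ... | αs , βs , π , βs⁻ | inj₁ (α , refl) = α ∷ αs , βs , prep _ π , βs⁻
  ... | αs , βs , π , βs⁻ | inj₂ e⁻ =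
    αs , e ∷ βs , ↭-trans (prep e π) (↭-sym (shift e _ βs)) , e⁻ ∷ βs⁻

  Admissible-[/] : ∀ {γ p e} → Positive⁺ γ → AllVars (_≺ p) γ → Admissible e →
                   occ true p (eqFm e) ≡ false → Admissible (substEq γ p e)
  Admissible-[/] {e = a ⟹ c} γ⁺ _ (negative e⁻) _ = negative (NoOcc-[/] (a ⇒⁺ c) e⁻ γ⁺)
  -- p⁻ rules out r ≡ p, so the head var⁺ r is untouched by the substitution.
  Admissible-[/] {p = p} γ⁺ γ≺ (defining {α} {r} α⁺ α≺) p⁻
    rewrite ∨-conicalʳ (occ false p α) (r ≡ᵇ p) p⁻ =
    defining (NoOcc-[/] α α⁺ γ⁺)
             (AllVars-[/] α α≺ (λ v≺r _ → v≺r) (λ p≺r oγ → ≺-trans (γ≺ oγ) p≺r))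

  eliminate : ∀ p Vs S → All Admissible S → All (AllVars (_∈ p ∷ Vs) ∘ eqFm) S →
              ∃ λ S′ → S ⇛⋆ S′ × All Admissible S′ × All (AllVars (_∈ Vs) ∘ eqFm) S′
  eliminate p Vs S adm vars with partition-defining p S adm
  ... | αs , βs , π , βs⁻ =
    map (substEq γ p) βs ,
    permute π ◅ ackermann p αs βs p∉αs βs⁻ ◅ ε ,
    map⁺ (All.zipWith (uncurry (Admissible-[/] γ⁺ γ≺)) (proj₂ (split adm) , βs⁻)) ,
    map⁺ (All.map (λ {β} → substituted-vars β) (proj₂ (split vars)))
    where
    split : ∀ {P : Eqn → Set} → All P S → All (P ∘ (_⟹ var⁺ p)) αs × All P βs
    split = Product.map₁ map⁻ ∘ ++⁻ _ ∘ All-resp-↭ π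
    αs-ok : All (Positive⁺ ∩ AllVars (_≺ p)) αs
    αs-ok = All.map Admissible-defining⁻ (proj₁ (split adm))
    p∉αs : All (λ α → occurs⁺ p α ≡ false) αs
    p∉αs = All.map (λ {α} (_ , α≺) → ¬Occurs⇒occurs⁺-false {p} {α} λ o → ≺⇒≢ (α≺ o) refl)
                   αs-ok
    γ : Fm⁺
    γ = ⋁⁺ αs
    γ⁺ : Positive⁺ γ
    γ⁺ = NoOcc-⋁⁺ (All.map proj₁ αs-ok)
    γ≺ : AllVars (_≺ p) γ
    γ≺ = AllVars-⋁⁺ (All.map proj₂ αs-ok)
    γ∈ : AllVars (_∈ Vs) γ
    γ∈ = AllVars-⋁⁺ (All.tabulate λ {α} α∈αs →
           defining-AllVars α (proj₂ (All.lookup αs-ok α∈αs)) (All.lookup (proj₁ (split vars)) α∈αs))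
    substituted-vars : ∀ β → AllVars (_∈ p ∷ Vs) (eqFm β) → AllVars (_∈ Vs) (eqFm (substEq γ p β))
    substituted-vars β β∈ = AllVars-[/] (eqFm β) β∈ ∈-∷⁻-≢ (λ _ → γ∈)

  eliminate-all : ∀ Vs S → All Admissible S → All (AllVars (_∈ Vs) ∘ eqFm) S →
                  ∃ λ S′ → S ⇛⋆ S′ × NoVars S′
  eliminate-all [] S _ vars = S , ε , All.map (λ {e} → AllVars-[]⇒hasVar-false {eqFm e}) vars
  eliminate-all (p ∷ Vs) S adm vars =
    let S′ , steps , adm′ , vars′ = eliminate p Vs S adm vars
        S″ , steps′ , noVars = eliminate-all Vs S′ adm′ vars′
    in S″ , steps ◅◅ steps′ , noVars

Acyclic⇒IsStrictPartialOrder : ∀ {ψ} → Acyclic ψ → IsStrictPartialOrder _≡_ (TransClosure (Edge ψ))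
Acyclic⇒IsStrictPartialOrder {ψ} acyclic = record
  { isEquivalence = isEquivalence
  ; irrefl        = λ { refl → acyclic _ }
  ; trans         = transitive (Edge ψ)
  ; <-resp-≈      = resp₂ _
  }

sqema-succeeds-on-disjunct : ∀ {ψ α} → MonadicInductive ψ → α ∈ disjuncts ψ →
                             ∃ λ S → initialSystem α ⇛⋆ S × NoVars S
sqema-succeeds-on-disjunct {ψ} {α} (regular , acyclic) α∈ =
  let S , steps , noVars =
        eliminate-all _ _ (++⁺ D.admissible []) (AllVars-allVars (D.solved ++ []))
  in S , D.steps ◅◅ steps , noVars
  where
  open Shapes (TransClosure (Edge ψ))
  open Decompose (TransClosure (Edge ψ))
  open Elimination (Acyclic⇒IsStrictPartialOrder acyclic)
  shape : InductiveDisjunct (step3 ⌜ α ⌝)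
  shape = InductiveDisjunct-sub (step3-subst-VarOrConst ⌜ α ⌝) (Regular-disjunct regular [_] α∈)
  module D = Decomposition (decompose {0} shape (initial-NomsAtMost α ∷ []))

disjunct-of-conjunct : ∀ {φ α} → ConjOfInductive φ → α ∈ disjuncts φ →
                       ∃ λ ψ → MonadicInductive ψ × α ∈ disjuncts ψ
disjunct-of-conjunct (single ind) α∈ = _ , ind , α∈
disjunct-of-conjunct (conj {φ} c₁ c₂) α∈ with ∈-++⁻ (disjuncts φ) α∈
... | inj₁ α∈₁ = disjunct-of-conjunct c₁ α∈₁
... | inj₂ α∈₂ = disjunct-of-conjunct c₂ α∈₂

theorem5p12 : ∀ (φ : Fm) → ConjOfInductive φ → SQEMASucceeds φ
theorem5p12 φ conjunction α α∈ =
  let ψ , ind , α∈ψ = disjunct-of-conjunct conjunction α∈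
  in sqema-succeeds-on-disjunct ind α∈ψ
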